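{- Let $$M_8=\begin{pmatrix}0&0\\ \ast&1\end{pmatrix},\quad M_9=\begin{pmatrix}0&1\\ 0&1\end{pmatrix},\quad M_{10}=\begin{pmatrix}0&0\\ 0&1\end{pmatrix}.$$ Then: (i) the minimal $M_8$-obstructions are exactly the digraphs on three vertices that admit no $M_8$-partition, together with all superorientations of $2K_2$; (ii) the minimal $M_9$-obstructions are exactly the digraphs on three vertices that admit no $M_9$-partition; (iii) the minimal $M_{10}$-obstructions are exactly the asymmetric arc (two vertices joined by exactly one arc), the biorientation of $2K_2$, and the biorientation of the path $P_3$ on three vertices.
   Context: Digraphs have no loops and no multiple arcs in the same direction. Given a $2\times2$ matrix $M$ over $\{0,1,\ast\}$, an $M$-partition of a digraph $D$ is a partition of $V_D$ into parts $V_1,V_2$ (possibly empty) such that: for each $i$, two distinct vertices of $V_i$ are non-adjacent if $M_{i,i}=0$, and joined by arcs in both directions if $M_{i,i}=1$; for $i\neq j$, every vertex of $V_i$ has an arc to every vertex of $V_j$ if $M_{i,j}=1$, and no vertex of $V_i$ has an arc to any vertex of $V_j$ if $M_{i,j}=0$; $\ast$ imposes no restriction. A minimal $M$-obstruction is a digraph that admits no $M$-partition but every proper induced subdigraph of which admits one. A superorientation of a graph $G$ is a digraph obtained by replacing each edge $xy$ of $G$ by the arc $(x,y)$, the arc $(y,x)$, or both. The biorientation of $G$ replaces every edge by arcs in both directions. $2K_2$ is the graph consisting of two disjoint edges; $P_3$ is the path with three vertices. -}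

module Defs where

open import Data.Nat using (ℕ; _<_)
open import Data.Fin using (Fin; zero; suc)
open import Data.Bool using (Bool; true; false; _∨_)
open import Data.Unit using (⊤)
open import Data.Product using (Σ; _×_; ∃)
open import Relation.Binary.PropositionalEquality using (_≡_; _≢_)
open import Relation.Nullary using (¬_)
open import Function.Bundles using (_⤖_; _↣_; Bijection; Injection)

record Digraph (n : ℕ) : Set where
  field
    arc      : Fin n → Fin n → Bool
    loopless : ∀ x → arc x x ≡ false
open Digraph public

data Entry : Set where
  𝟘 𝟙 ∗ : Entry

Matrix : Set
Matrix = Fin 2 → Fin 2 → Entry

-- What an entry demands of the arc (x,y) with x in V_i, y in V_j, x ≠ y.
Respects : Entry → Bool → Set
Respects 𝟘 b = b ≡ false
Respects 𝟙 b = b ≡ true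
Respects ∗ b = ⊤

-- part x = index of the part containing x (parts may be empty).
IsMPartition : Matrix → ∀ {n} → Digraph n → (Fin n → Fin 2) → Set
IsMPartition M D part =
  ∀ x y → x ≢ y → Respects (M (part x) (part y)) (arc D x y)

HasMPartition : Matrix → ∀ {n} → Digraph n → Set
HasMPartition M {n} D = Σ (Fin n → Fin 2) (IsMPartition M D)

induced : ∀ {n m} → Digraph n → Fin m ↣ Fin n → Digraph m
induced D f = record
  { arc = λ i j → arc D (Injection.to f i) (Injection.to f j)
  ; loopless = λ i → loopless D (Injection.to f i) }

-- Minimal M-obstruction: no M-partition, but every proper induced subdigraph
-- (vertex set a proper subset, i.e. image of an injection from Fin m with m < n) has one.
MinimalObstruction : Matrix → ∀ {n} → Digraph n → Set
MinimalObstruction M {n} D =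
  ¬ HasMPartition M D ×
  (∀ m (f : Fin m ↣ Fin n) → m < n → HasMPartition M (induced D f))

Isomorphic : ∀ {n m} → Digraph n → Digraph m → Set
Isomorphic {n} {m} D E =
  Σ (Fin n ⤖ Fin m) λ σ →
    ∀ x y → arc D x y ≡ arc E (Bijection.to σ x) (Bijection.to σ y)

-- Graphs given by a symmetric irreflexive Bool adjacency.
IsSuperorientationOf : ∀ {n} → (Fin n → Fin n → Bool) → Digraph n → Set
IsSuperorientationOf G E =
  ∀ x y → (G x y ≡ true → (arc E x y ∨ arc E y x) ≡ true)
        × (G x y ≡ false → arc E x y ≡ false)

SuperorientationOf : ∀ {m} → (Fin m → Fin m → Bool) → ∀ {n} → Digraph n → Set
SuperorientationOf {m} G D = Σ (Digraph m) λ E → IsSuperorientationOf G E × Isomorphic D E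

twoK2 : Fin 4 → Fin 4 → Bool
twoK2 zero (suc zero) = true
twoK2 (suc zero) zero = true
twoK2 (suc (suc zero)) (suc (suc (suc zero))) = true
twoK2 (suc (suc (suc zero))) (suc (suc zero)) = true
twoK2 _ _ = false

P3 : Fin 3 → Fin 3 → Bool
P3 zero (suc zero) = true
P3 (suc zero) zero = true
P3 (suc zero) (suc (suc zero)) = true
P3 (suc (suc zero)) (suc zero) = true
P3 _ _ = false

bio2K2 : Digraph 4
bio2K2 = record { arc = twoK2 ; loopless = λ { zero → _≡_.refl ; (suc zero) → _≡_.refl
  ; (suc (suc zero)) → _≡_.refl ; (suc (suc (suc zero))) → _≡_.refl } }

bioP3 : Digraph 3
bioP3 = record { arc = P3 ; loopless = λ { zero → _≡_.refl ; (suc zero) → _≡_.refl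
  ; (suc (suc zero)) → _≡_.refl } }

asymArcAdj : Fin 2 → Fin 2 → Bool
asymArcAdj zero (suc zero) = true
asymArcAdj _ _ = false

asymArc : Digraph 2
asymArc = record { arc = asymArcAdj ; loopless = λ { zero → _≡_.refl ; (suc zero) → _≡_.refl } }

M8 M9 M10 : Matrix
M8 zero zero = 𝟘
M8 zero (suc zero) = 𝟘
M8 (suc zero) zero = ∗
M8 (suc zero) (suc zero) = 𝟙
M9 zero zero = 𝟘
M9 zero (suc zero) = 𝟙
M9 (suc zero) zero = 𝟘
M9 (suc zero) (suc zero) = 𝟙
M10 zero zero = 𝟘
M10 zero (suc zero) = 𝟘
M10 (suc zero) zero = 𝟘
M10 (suc zero) (suc zero) = 𝟙

-- For M8 and M10 every non-sink is forced into V₂, which must be a biclique, so a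
-- digraph is obstructed as soon as it has a conflict: two distinct non-sinks x, y
-- without the arc (x, y). Conversely, in the absence of conflicts (and, for M10, of
-- asymmetric arcs) the non-sinks can be taken as V₂. In a minimal obstruction on at
-- least four vertices no conflict fits on three vertices; this excludes every arc
-- between the two edges x → x', y → y' of a conflict, so they span a superorientation
-- of 2K2. For M10 the obstruction is moreover symmetric, and on three vertices a
-- symmetric conflict is an induced P3. For M9 the part of a vertex y is read off any
-- arc into y, so a partition exists as soon as every triple has one.

module Submission where

open import Defs
open import Data.Nat using (ℕ; zero; suc; _<_; _≤_; _≤?_; s≤s)
open import Data.Nat.Properties using (<⇒≱; ≰⇒>; ≤∧≢⇒<; <-≤-trans) renaming (_≟_ to _≟ℕ_)
open import Data.Bool using (Bool; true; false; _∨_)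
open import Data.Bool.Properties using (¬-not; ∨-idem; ∨-zeroʳ) renaming (_≟_ to _≟ᵇ_)
open import Data.Unit using (tt)
open import Data.Fin using (Fin; _≟_; punchIn; punchOut)
open import Data.Fin.Patterns using (0F; 1F; 2F; 3F)
open import Data.Fin.Properties
  using (any?; all?; injective⇒≤; punchIn-injective; punchInᵢ≢i; punchOut-injective; punchIn-punchOut)
open import Data.Fin.Subset using (Subset)
open import Data.Fin.Subset.Properties using (anySubset?)
open import Data.Product using (Σ; ∃; ∃₂; _×_; _,_; proj₁; proj₂)
open import Data.Sum using (_⊎_; inj₁; inj₂; [_,_])
open import Data.Vec using (Vec; []; _∷_; lookup)
open import Data.Vec.Relation.Unary.All using ([]; _∷_)
open import Data.Vec.Relation.Unary.AllPairs using ([]; _∷_)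
open import Data.Vec.Relation.Unary.Unique.Propositional using (Unique)
open import Data.Vec.Relation.Unary.Unique.Propositional.Properties using (lookup-injective)
open import Function using (_∘_; id)
open import Function.Bundles using (_⇔_; mk⇔; _↣_; mk↣; mk⤖; Injection; Bijection)
open import Function.Consequences.Propositional using (strictlySurjective⇒surjective)
open import Function.Definitions using (Injective)
open import Relation.Binary.PropositionalEquality
  using (_≡_; _≢_; refl; sym; trans; cong; cong₂; subst; ≢-sym; module ≡-Reasoning)
open import Relation.Nullary using (¬_; Dec; yes; no; does)
open import Relation.Nullary.Decidable using (True; toWitness; ¬?; _×-dec_; _→-dec_)
open import Relation.Nullary.Negation using (contradiction)

private
  variable
    k m n : ℕ

open Injection using (to)

arc⇒≢ : (D : Digraph n) {x y : Fin n} → arc D x y ≡ true → x ≢ y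
arc⇒≢ D {x} xy refl = contradiction (trans (sym xy) (loopless D x)) λ ()

arc-split⇒≢ : {D : Digraph n} {x y z : Fin n} → arc D x y ≡ true → arc D x z ≡ false → y ≢ z
arc-split⇒≢ xy xz refl = contradiction (trans (sym xy) xz) λ ()

NonSink : Digraph n → Fin n → Set
NonSink D x = ∃ λ z → arc D x z ≡ true

nonSink? : (D : Digraph n) → ∀ x → Dec (NonSink D x)
nonSink? D x = any? λ z → arc D x z ≟ᵇ true

sink-arc : {D : Digraph n} {x : Fin n} → ¬ NonSink D x → ∀ y → arc D x y ≡ false
sink-arc ¬sx y = ¬-not λ xy → ¬sx (y , xy)

AsymmetricArc : Digraph n → Set
AsymmetricArc D = ∃₂ λ x y → arc D x y ≡ true × arc D y x ≡ false

asymmetricArc? : (D : Digraph n) → Dec (AsymmetricArc D)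
asymmetricArc? D = any? λ x → any? λ y → (arc D x y ≟ᵇ true) ×-dec (arc D y x ≟ᵇ false)

Symmetric : Digraph n → Set
Symmetric D = ∀ x y → arc D x y ≡ arc D y x

¬asymmetric⇒symmetric : {D : Digraph n} → ¬ AsymmetricArc D → Symmetric D
¬asymmetric⇒symmetric {D = D} ¬asym x y with arc D x y in xy | arc D y x in yx
... | true  | true  = refl
... | false | false = refl
... | true  | false = contradiction (x , y , xy , yx) ¬asym
... | false | true  = contradiction (y , x , yx , xy) ¬asym

vertices : (xs : Vec (Fin n) k) → Unique xs → Fin k ↣ Fin n
vertices xs unique = mk↣ {to = lookup xs} (lookup-injective unique _ _)

_∖_ : Digraph (suc n) → Fin (suc n) → Digraph n
D ∖ v = induced D (mk↣ {to = punchIn v} (punchIn-injective v _ _))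

fromBool : Bool → Fin 2
fromBool false = 0F
fromBool true  = 1F

fromBool-injective : Injective _≡_ _≡_ fromBool
fromBool-injective {false} {false} _ = refl
fromBool-injective {true}  {true}  _ = refl

record Embedding (E : Digraph m) (D : Digraph n) : Set where
  constructor embedding
  field
    map       : Fin m → Fin n
    injective : Injective _≡_ _≡_ map
    arc-map   : ∀ i j → arc E i j ≡ arc D (map i) (map j)

pullback : ∀ M {E : Digraph m} {D : Digraph n} →
           Embedding E D → HasMPartition M D → HasMPartition M E
pullback M (embedding g g-injective g-arc) (part , valid) =
  part ∘ g , λ i j i≢j → subst (Respects (M (part (g i)) (part (g j)))) (sym (g-arc i j))
                                (valid (g i) (g j) (i≢j ∘ g-injective))

avoiding⇒< : {t : Fin k → Fin n} → Injective _≡_ _≡_ t → ∀ {v} → (∀ i → t i ≢ v) → k < n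
avoiding⇒< {n = zero}  _           {()}
avoiding⇒< {n = suc n} t-injective miss =
  s≤s (injective⇒≤ {f = λ i → punchOut (miss i ∘ sym)}
                   λ {i} {j} → t-injective ∘ punchOut-injective (miss i ∘ sym) (miss j ∘ sym))

injection-surjective : {t : Fin k → Fin n} → Injective _≡_ _≡_ t → n ≤ k →
                       ∀ v → ∃ λ i → t i ≡ v
injection-surjective {t = t} t-injective n≤k v with any? (λ i → t i ≟ v)
... | yes hit  = hit
... | no ¬hit = contradiction n≤k (<⇒≱ (avoiding⇒< t-injective λ i eq → ¬hit (i , eq)))

missing-vertex : (f : Fin m ↣ Fin n) → m < n → ∃ λ v → ∀ i → to f i ≢ v
missing-vertex {m} {n} f m<n with any? (λ v → all? λ i → ¬? (to f i ≟ v))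
... | yes found = found
... | no ¬found = contradiction (injective⇒≤ {f = preimage} preimage-injective) (<⇒≱ m<n)
  where
  preimage-of : ∀ v → ∃ λ i → to f i ≡ v
  preimage-of v with any? (λ i → to f i ≟ v)
  ... | yes hit  = hit
  ... | no ¬hit = contradiction (v , λ i eq → ¬hit (i , eq)) ¬found

  preimage : Fin n → Fin m
  preimage = proj₁ ∘ preimage-of

  preimage-injective : Injective _≡_ _≡_ preimage
  preimage-injective {v} {w} eq =
    trans (sym (proj₂ (preimage-of v))) (trans (cong (to f) eq) (proj₂ (preimage-of w)))

spanning⇒isomorphic : {D : Digraph n} {E : Digraph k} (t : Fin k ↣ Fin n) → n ≤ k →
                      (∀ i j → arc D (to t i) (to t j) ≡ arc E i j) → Isomorphic D E
spanning⇒isomorphic {D = D} {E} t n≤k t-arc =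
  mk⤖ (σ-injective , strictlySurjective⇒surjective σ-onto) , σ-arc
  where
  onto = injection-surjective (Injection.injective t) n≤k

  σ = proj₁ ∘ onto

  t∘σ : ∀ x → to t (σ x) ≡ x
  t∘σ = proj₂ ∘ onto

  σ-injective : Injective _≡_ _≡_ σ
  σ-injective {x} {y} eq = trans (sym (t∘σ x)) (trans (cong (to t) eq) (t∘σ y))

  σ-onto : ∀ i → ∃ λ x → σ x ≡ i
  σ-onto i = to t i , Injection.injective t (t∘σ (to t i))

  σ-arc : ∀ x y → arc D x y ≡ arc E (σ x) (σ y)
  σ-arc x y = trans (sym (cong₂ (arc D) (t∘σ x) (t∘σ y))) (t-arc (σ x) (σ y))

minimal-bound : ∀ M {D : Digraph n} → MinimalObstruction M D → (t : Fin k ↣ Fin n) →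
                ¬ HasMPartition M (induced D t) → n ≤ k
minimal-bound {n} {k} _ (_ , proper) t ¬part with n ≤? k
... | yes n≤k = n≤k
... | no n≰k = contradiction (proper k t (≰⇒> n≰k)) ¬part

avoiding-embeds-in-deletion : {D : Digraph (suc n)} (f : Fin m ↣ Fin (suc n)) {v : Fin (suc n)} →
                              (∀ i → to f i ≢ v) → Embedding (induced D f) (D ∖ v)
avoiding-embeds-in-deletion {D = D} f miss =
  embedding (λ i → punchOut (miss i ∘ sym))
            (λ {i} {j} → Injection.injective f ∘ punchOut-injective (miss i ∘ sym) (miss j ∘ sym))
            λ i j → sym (cong₂ (arc D) (punchIn-punchOut _) (punchIn-punchOut _))

minimal-by-deletions : ∀ M {D : Digraph (suc n)} → ¬ HasMPartition M D →
                       (∀ v → HasMPartition M (D ∖ v)) → MinimalObstruction M D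
minimal-by-deletions M {D} ¬part deletions = ¬part , λ m f m<n →
  let v , miss = missing-vertex f m<n
  in pullback M (avoiding-embeds-in-deletion {D = D} f miss) (deletions v)

isomorphic-minimal : ∀ M {D : Digraph n} {E : Digraph k} →
                     MinimalObstruction M E → Isomorphic D E → MinimalObstruction M D
isomorphic-minimal {n} {k} M {D} {E} (¬partE , properE) (σ , σ-arc) = ¬partD , properD
  where
  open Bijection σ using (to⁻; strictlySurjective) renaming (to to σ→; injective to σ-injective)

  σ∘to⁻ : ∀ i → σ→ (to⁻ i) ≡ i
  σ∘to⁻ = proj₂ ∘ strictlySurjective

  inverse : Embedding E D
  inverse = embedding to⁻
    (λ {i} {j} eq → trans (sym (σ∘to⁻ i)) (trans (cong σ→ eq) (σ∘to⁻ j)))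
    λ i j → sym (trans (σ-arc (to⁻ i) (to⁻ j)) (cong₂ (arc E) (σ∘to⁻ i) (σ∘to⁻ j)))

  ¬partD : ¬ HasMPartition M D
  ¬partD = ¬partE ∘ pullback M inverse

  properD : ∀ m (f : Fin m ↣ Fin n) → m < n → HasMPartition M (induced D f)
  properD m f m<n =
    pullback M {E = induced D f} {D = induced E σf} (embedding id id λ i j → σ-arc (to f i) (to f j))
               (properE m σf (<-≤-trans m<n (injective⇒≤ σ-injective)))
    where
    σf : Fin m ↣ Fin k
    σf = mk↣ (Injection.injective f ∘ σ-injective)

RealisesEveryPair : Matrix → Set
RealisesEveryPair M = ∀ a b → ∃₂ λ i j → Respects (M i j) a × Respects (M j i) b

small-partition : ∀ {M} → RealisesEveryPair M → m < 3 → (D : Digraph m) → HasMPartition M D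
small-partition {m = 0} _ _ D = (λ ()) , λ ()
small-partition {m = 1} _ _ D = (λ _ → 0F) , λ { 0F 0F 0≢0 → contradiction refl 0≢0 }
small-partition {m = 2} {M} realise _ D with realise (arc D 0F 1F) (arc D 1F 0F)
... | i , j , r₀₁ , r₁₀ = part , valid
  where
  part : Fin 2 → Fin 2
  part 0F = i
  part 1F = j

  valid : IsMPartition M D part
  valid 0F 0F 0≢0 = contradiction refl 0≢0
  valid 0F 1F _   = r₀₁
  valid 1F 0F _   = r₁₀
  valid 1F 1F 1≢1 = contradiction refl 1≢1
small-partition {m = suc (suc (suc _))} _ (s≤s (s≤s (s≤s ()))) D

order-three : ∀ M {D : Digraph n} → RealisesEveryPair M → MinimalObstruction M D → n ≤ 3 → n ≡ 3
order-three {n} _ {D} realise (¬part , _) n≤3 with n ≟ℕ 3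
... | yes n≡3 = n≡3
... | no n≢3  = contradiction (small-partition realise (≤∧≢⇒< n≤3 n≢3) D) ¬part

three-vertex-minimal : ∀ M {D : Digraph 3} → RealisesEveryPair M → ¬ HasMPartition M D →
                       MinimalObstruction M D
three-vertex-minimal _ {D} realise ¬part =
  ¬part , λ _ f m<3 → small-partition realise m<3 (induced D f)

realises-M8 : RealisesEveryPair M8
realises-M8 false false = 0F , 0F , refl , refl
realises-M8 true  false = 1F , 0F , tt , refl
realises-M8 false true  = 0F , 1F , refl , tt
realises-M8 true  true  = 1F , 1F , refl , refl

realises-M9 : RealisesEveryPair M9
realises-M9 false false = 0F , 0F , refl , refl
realises-M9 true  false = 0F , 1F , refl , refl
realises-M9 false true  = 1F , 0F , refl , refl
realises-M9 true  true  = 1F , 1F , refl , refl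

respects? : ∀ e b → Dec (Respects e b)
respects? 𝟘 b = b ≟ᵇ false
respects? 𝟙 b = b ≟ᵇ true
respects? ∗ _ = yes tt

isMPartition? : ∀ M (D : Digraph n) part → Dec (IsMPartition M D part)
isMPartition? M D part = all? λ x → all? λ y → ¬? (x ≟ y) →-dec respects? _ _

-- Partitions are enumerated through their part V₂, as a subset of the vertices.
HasSubsetPartition : Matrix → Digraph n → Set
HasSubsetPartition {n} M D = ∃ λ (V₂ : Subset n) → IsMPartition M D (fromBool ∘ lookup V₂)

hasSubsetPartition? : ∀ M (D : Digraph n) → Dec (HasSubsetPartition M D)
hasSubsetPartition? M D = anySubset? λ V₂ → isMPartition? M D (fromBool ∘ lookup V₂)

subset-partition : ∀ M {D : Digraph n} → HasSubsetPartition M D → HasMPartition M D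
subset-partition _ (V₂ , valid) = fromBool ∘ lookup V₂ , valid

minimal-by-deletion-search : ∀ M (D : Digraph (suc n)) → ¬ HasMPartition M D →
                             True (all? λ v → hasSubsetPartition? M (D ∖ v)) →
                             MinimalObstruction M D
minimal-by-deletion-search M D ¬part found =
  minimal-by-deletions M {D} ¬part (subset-partition M {D ∖ _} ∘ toWitness found)

allBool? : {P : Bool → Set} → (∀ b → Dec (P b)) → Dec (∀ b → P b)
allBool? P? with P? false | P? true
... | yes pf | yes pt = yes λ { false → pf ; true → pt }
... | no ¬pf | _      = no λ all → ¬pf (all false)
... | _      | no ¬pt = no λ all → ¬pt (all true)

-- Matrices of the shape (𝟘 𝟘 ; _ 𝟙)

record SinkSplit (M : Matrix) : Set where
  field
    sink-row  : ∀ j → M 0F j ≡ 𝟘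
    V₂-clique : M 1F 1F ≡ 𝟙

sinkSplit-M8 : SinkSplit M8
sinkSplit-M8 = record { sink-row = λ { 0F → refl ; 1F → refl } ; V₂-clique = refl }

sinkSplit-M10 : SinkSplit M10
sinkSplit-M10 = record { sink-row = λ { 0F → refl ; 1F → refl } ; V₂-clique = refl }

Conflict : Digraph n → Fin n → Fin n → Set
Conflict D x y = x ≢ y × NonSink D x × NonSink D y × arc D x y ≡ false

HasConflict : Digraph n → Set
HasConflict D = ∃₂ (Conflict D)

hasConflict? : (D : Digraph n) → Dec (HasConflict D)
hasConflict? D = any? λ x → any? λ y →
  ¬? (x ≟ y) ×-dec nonSink? D x ×-dec nonSink? D y ×-dec (arc D x y ≟ᵇ false)

module SinkSplitPartitions {M : Matrix} (split : SinkSplit M) where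
  open SinkSplit split

  arc-source-in-V₂ : ∀ i j → Respects (M i j) true → i ≡ 1F
  arc-source-in-V₂ 0F j r = contradiction (subst (λ e → Respects e true) (sink-row j) r) λ ()
  arc-source-in-V₂ 1F j _ = refl

  nonSink-in-V₂ : {D : Digraph n} {part : Fin n → Fin 2} {x : Fin n} →
                  IsMPartition M D part → NonSink D x → part x ≡ 1F
  nonSink-in-V₂ {D = D} {part} {x} valid (z , xz) =
    arc-source-in-V₂ (part x) (part z)
      (subst (Respects (M (part x) (part z))) xz (valid x z (arc⇒≢ D xz)))

  V₂-adjacent : {D : Digraph n} {part : Fin n → Fin 2} {x y : Fin n} →
                IsMPartition M D part → x ≢ y → part x ≡ 1F → part y ≡ 1F → arc D x y ≡ true
  V₂-adjacent {D = D} {x = x} {y} valid x≢y px py =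
    subst (λ e → Respects e (arc D x y)) (trans (cong₂ M px py) V₂-clique) (valid x y x≢y)

  conflict⇒¬partition : {D : Digraph n} {x y : Fin n} → Conflict D x y → ¬ HasMPartition M D
  conflict⇒¬partition {D = D} (x≢y , sx , sy , xy) (_ , valid) =
    contradiction (trans (sym xy) (V₂-adjacent {D = D} valid x≢y (in-V₂ sx) (in-V₂ sy))) λ ()
    where
    in-V₂ = λ {z} → nonSink-in-V₂ {D = D} {x = z} valid

  -- The non-sinks form V₂ and the sinks V₁.
  ¬conflict⇒partition : {D : Digraph n} →
                        (∀ {x y} → NonSink D x → ¬ NonSink D y → Respects (M 1F 0F) (arc D x y)) →
                        ¬ HasConflict D → HasMPartition M D
  ¬conflict⇒partition {D = D} into-sink ¬conflict =
    (λ x → fromBool (does (nonSink? D x))) , λ x y x≢y → valid x≢y (nonSink? D x) (nonSink? D y)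
    where
    valid : ∀ {x y} → x ≢ y → (sx? : Dec (NonSink D x)) (sy? : Dec (NonSink D y)) →
            Respects (M (fromBool (does sx?)) (fromBool (does sy?))) (arc D x y)
    valid {x} {y} x≢y (yes sx) (yes sy) =
      subst (λ e → Respects e (arc D x y)) (sym V₂-clique)
            (¬-not λ xy → ¬conflict (x , y , x≢y , sx , sy , xy))
    valid x≢y (yes sx) (no ¬sy) = into-sink sx ¬sy
    valid {x} {y} x≢y (no ¬sx) _ =
      subst (λ e → Respects e (arc D x y)) (sym (sink-row _)) (sink-arc {D = D} ¬sx y)

module LargeObstruction {M : Matrix} (split : SinkSplit M) {D : Digraph n}
                        (minimal : MinimalObstruction M D) (large : 3 < n) where
  open SinkSplitPartitions split

  no-conflict-on-three : (xs : Vec (Fin n) 3) (unique : Unique xs) {i j : Fin 3} →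
                         ¬ Conflict (induced D (vertices xs unique)) i j
  no-conflict-on-three xs unique c =
    <⇒≱ large (minimal-bound M {D} minimal (vertices xs unique)
                 (conflict⇒¬partition {D = induced D (vertices xs unique)} c))

  -- If y' were x or x', the conflict would live on the three vertices x, x', y.
  fresh-target : {x x' y y' : Fin n} → x ≢ y → arc D x x' ≡ true → arc D y y' ≡ true →
                 arc D x y ≡ false → y' ≢ x × y' ≢ x'
  fresh-target {x} {x'} {y} x≢y xx' yy' xy =
    (λ { refl → no-conflict-on-three _ unique (conflict 0F yy') }) ,
    (λ { refl → no-conflict-on-three _ unique (conflict 1F yy') })
    where
    unique : Unique (x ∷ x' ∷ y ∷ [])
    unique = (arc⇒≢ D xx' ∷ x≢y ∷ []) ∷ (arc-split⇒≢ {D = D} xx' xy ∷ []) ∷ [] ∷ []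

    conflict : ∀ i → arc D y (lookup (x ∷ x' ∷ y ∷ []) i) ≡ true →
               Conflict (induced D (vertices _ unique)) 0F 2F
    conflict i yi = (λ ()) , (1F , xx') , (i , yi) , xy

  cross-arcs : {x x' y y' : Fin n} → x ≢ y → arc D x x' ≡ true → arc D y y' ≡ true →
               arc D x y ≡ false → arc D y x' ≡ false × arc D x' y ≡ false × arc D x' y' ≡ false
  cross-arcs x≢y xx' yy' xy = yx' , x'y , x'y'
    where
    yx' = ¬-not λ yx' → proj₂ (fresh-target x≢y xx' yx' xy) refl
    y≢x' = ≢-sym (arc-split⇒≢ {D = D} xx' xy)
    x'y = ¬-not λ x'y → proj₁ (fresh-target y≢x' yy' x'y yx') refl
    x'y' = ¬-not λ x'y' → proj₂ (fresh-target y≢x' yy' x'y' yx') refl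

  conflict-superorientation :
    {x x' y y' : Fin n} (x≢y : x ≢ y) (xx' : arc D x x' ≡ true) (yy' : arc D y y' ≡ true)
    (xy : arc D x y ≡ false) (unique : Unique (x ∷ x' ∷ y ∷ y' ∷ [])) →
    IsSuperorientationOf twoK2 (induced D (vertices _ unique))
  conflict-superorientation {x} {y = y} x≢y xx' yy' xy unique = superorientation
    where
    E = induced D (vertices _ unique)

    yx : arc D y x ≡ false
    yx = ¬-not λ yx → proj₁ (fresh-target x≢y xx' yx xy) refl

    yx'&x'y&x'y' = cross-arcs x≢y xx' yy' xy
    xy'&y'x&y'x' = cross-arcs (≢-sym x≢y) yy' xx' yx

    At : Bool → Fin 4 → Fin 4 → Set
    At g i j = (g ≡ true → (arc E i j ∨ arc E j i) ≡ true) × (g ≡ false → arc E i j ≡ false)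

    edge : ∀ i j → arc E i j ≡ true → At true i j
    edge i j ij = (λ _ → cong (_∨ arc E j i) ij) , λ ()

    reverse-edge : ∀ i j → arc E j i ≡ true → At true i j
    reverse-edge i j ji = (λ _ → trans (cong (arc E i j ∨_) ji) (∨-zeroʳ (arc E i j))) , λ ()

    non-edge : ∀ i j → arc E i j ≡ false → At false i j
    non-edge _ _ ij = (λ ()) , λ _ → ij

    superorientation : IsSuperorientationOf twoK2 E
    superorientation 0F 0F = non-edge 0F 0F (loopless E 0F)
    superorientation 0F 1F = edge 0F 1F xx'
    superorientation 0F 2F = non-edge 0F 2F xy
    superorientation 0F 3F = non-edge 0F 3F (proj₁ xy'&y'x&y'x')
    superorientation 1F 0F = reverse-edge 1F 0F xx'
    superorientation 1F 1F = non-edge 1F 1F (loopless E 1F)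
    superorientation 1F 2F = non-edge 1F 2F (proj₁ (proj₂ yx'&x'y&x'y'))
    superorientation 1F 3F = non-edge 1F 3F (proj₂ (proj₂ yx'&x'y&x'y'))
    superorientation 2F 0F = non-edge 2F 0F yx
    superorientation 2F 1F = non-edge 2F 1F (proj₁ yx'&x'y&x'y')
    superorientation 2F 2F = non-edge 2F 2F (loopless E 2F)
    superorientation 2F 3F = edge 2F 3F yy'
    superorientation 3F 0F = non-edge 3F 0F (proj₁ (proj₂ xy'&y'x&y'x'))
    superorientation 3F 1F = non-edge 3F 1F (proj₂ (proj₂ xy'&y'x&y'x'))
    superorientation 3F 2F = reverse-edge 3F 2F yy'
    superorientation 3F 3F = non-edge 3F 3F (loopless E 3F)

  conflict-spans-2K2 : {x y : Fin n} → Conflict D x y →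
                       Σ (Fin 4 ↣ Fin n) λ q → n ≤ 4 × IsSuperorientationOf twoK2 (induced D q)
  conflict-spans-2K2 {x} {y} (x≢y , (x' , xx') , (y' , yy') , xy) =
    q , n≤4 , conflict-superorientation x≢y xx' yy' xy unique
    where
    y'-fresh = fresh-target x≢y xx' yy' xy

    unique : Unique (x ∷ x' ∷ y ∷ y' ∷ [])
    unique = (arc⇒≢ D xx' ∷ x≢y ∷ ≢-sym (proj₁ y'-fresh) ∷ [])
           ∷ (arc-split⇒≢ {D = D} xx' xy ∷ ≢-sym (proj₂ y'-fresh) ∷ [])
           ∷ (arc⇒≢ D yy' ∷ [])
           ∷ [] ∷ []

    q = vertices _ unique

    n≤4 : n ≤ 4
    n≤4 = minimal-bound M {D} minimal q
      (conflict⇒¬partition {D = induced D q} {0F} {2F} ((λ ()) , (1F , xx') , (3F , yy') , xy))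

symmetric-superorientation : {G : Fin n → Fin n → Bool} {E : Digraph n} →
                             Symmetric E → IsSuperorientationOf G E →
                             ∀ x y → arc E x y ≡ G x y
symmetric-superorientation {G = G} {E} symmetric superorientation x y with G x y in gxy
... | false = proj₂ (superorientation x y) gxy
... | true  = begin
  arc E x y               ≡⟨ sym (∨-idem (arc E x y)) ⟩
  arc E x y ∨ arc E x y   ≡⟨ cong (arc E x y ∨_) (symmetric x y) ⟩
  arc E x y ∨ arc E y x   ≡⟨ proj₁ (superorientation x y) gxy ⟩
  true                    ∎
  where open ≡-Reasoning

edge-source : {D : Digraph n} {a b : Fin n} → (arc D a b ∨ arc D b a) ≡ true →
              NonSink D a ⊎ NonSink D b
edge-source {D = D} {a} {b} ab∨ba with arc D a b in ab
... | true  = inj₁ (b , ab)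
... | false = inj₂ (a , ab∨ba)

superorientation-2K2-conflict : {E : Digraph 4} → IsSuperorientationOf twoK2 E → HasConflict E
superorientation-2K2-conflict {E} superorientation
  with edge-source {D = E} (proj₁ (superorientation 0F 1F) refl)
     | edge-source {D = E} (proj₁ (superorientation 2F 3F) refl)
... | inj₁ s₀ | inj₁ s₂ = 0F , 2F , (λ ()) , s₀ , s₂ , proj₂ (superorientation 0F 2F) refl
... | inj₁ s₀ | inj₂ s₃ = 0F , 3F , (λ ()) , s₀ , s₃ , proj₂ (superorientation 0F 3F) refl
... | inj₂ s₁ | inj₁ s₂ = 1F , 2F , (λ ()) , s₁ , s₂ , proj₂ (superorientation 1F 2F) refl
... | inj₂ s₁ | inj₂ s₃ = 1F , 3F , (λ ()) , s₁ , s₃ , proj₂ (superorientation 1F 3F) refl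

-- The digraphs on Fin 4 with arcs only along the edges of 2K2, the arguments being
-- the arcs 0 → 1, 1 → 0, 2 → 3 and 3 → 2.
on2K2 : Bool → Bool → Bool → Bool → Digraph 4
on2K2 a b c d = record
  { arc      = arcs
  ; loopless = λ { 0F → refl ; 1F → refl ; 2F → refl ; 3F → refl }
  }
  where
  arcs : Fin 4 → Fin 4 → Bool
  arcs 0F 1F = a
  arcs 1F 0F = b
  arcs 2F 3F = c
  arcs 3F 2F = d
  arcs _  _  = false

on2K2-deletions : ∀ a b c d v → HasMPartition M8 (on2K2 a b c d ∖ v)
on2K2-deletions a b c d v = subset-partition M8 {on2K2 a b c d ∖ v} (search a b c d v)
  where
  search : ∀ a b c d v → HasSubsetPartition M8 (on2K2 a b c d ∖ v)
  search = toWitness {a? = allBool? λ a → allBool? λ b → allBool? λ c → allBool? λ d →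
                           all? λ v → hasSubsetPartition? M8 (on2K2 a b c d ∖ v)} _

superorientation-2K2-minimal : (E : Digraph 4) → IsSuperorientationOf twoK2 E →
                               MinimalObstruction M8 E
superorientation-2K2-minimal E superorientation =
  minimal-by-deletions M8 {E} ¬part λ v →
    pullback M8 {E = E ∖ v} {D = F ∖ v}
                (embedding id id λ i j → same-arcs (punchIn v i) (punchIn v j))
                (on2K2-deletions _ _ _ _ v)
  where
  open SinkSplitPartitions sinkSplit-M8

  ¬part : ¬ HasMPartition M8 E
  ¬part = let _ , _ , conflict = superorientation-2K2-conflict {E} superorientation
          in conflict⇒¬partition {D = E} conflict

  F = on2K2 (arc E 0F 1F) (arc E 1F 0F) (arc E 2F 3F) (arc E 3F 2F)

  off-edge : ∀ i j → twoK2 i j ≡ false → arc E i j ≡ false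
  off-edge i j = proj₂ (superorientation i j)

  same-arcs : ∀ i j → arc E i j ≡ arc F i j
  same-arcs 0F 0F = loopless E 0F
  same-arcs 0F 1F = refl
  same-arcs 0F 2F = off-edge 0F 2F refl
  same-arcs 0F 3F = off-edge 0F 3F refl
  same-arcs 1F 0F = refl
  same-arcs 1F 1F = loopless E 1F
  same-arcs 1F 2F = off-edge 1F 2F refl
  same-arcs 1F 3F = off-edge 1F 3F refl
  same-arcs 2F 0F = off-edge 2F 0F refl
  same-arcs 2F 1F = off-edge 2F 1F refl
  same-arcs 2F 2F = loopless E 2F
  same-arcs 2F 3F = refl
  same-arcs 3F 0F = off-edge 3F 0F refl
  same-arcs 3F 1F = off-edge 3F 1F refl
  same-arcs 3F 2F = refl
  same-arcs 3F 3F = loopless E 3F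

-- M8

minimal-M8⇒ : (D : Digraph n) → MinimalObstruction M8 D →
              (n ≡ 3 × ¬ HasMPartition M8 D) ⊎ SuperorientationOf twoK2 D
minimal-M8⇒ {n} D minimal@(¬part , _) with n ≤? 3 | hasConflict? D
... | yes n≤3 | _      = inj₁ (order-three M8 {D} realises-M8 minimal n≤3 , ¬part)
... | no _    | no ¬c = contradiction (¬conflict⇒partition {D = D} (λ _ _ → tt) ¬c) ¬part
  where open SinkSplitPartitions sinkSplit-M8
... | no n≰3  | yes (_ , _ , c) =
  let q , n≤4 , superorientation = conflict-spans-2K2 c
  in inj₂ (induced D q , superorientation ,
           spanning⇒isomorphic {D = D} {E = induced D q} q n≤4 λ _ _ → refl)
  where open LargeObstruction sinkSplit-M8 {D = D} minimal (≰⇒> n≰3)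

minimal-M8⇐ : (D : Digraph n) → (n ≡ 3 × ¬ HasMPartition M8 D) ⊎ SuperorientationOf twoK2 D →
              MinimalObstruction M8 D
minimal-M8⇐ D (inj₁ (refl , ¬part)) = three-vertex-minimal M8 {D} realises-M8 ¬part
minimal-M8⇐ D (inj₂ (E , superorientation , D≅E)) =
  isomorphic-minimal M8 {D} {E} (superorientation-2K2-minimal E superorientation) D≅E

-- M9

-- Under M9 the arc (x, y) is present exactly when y lies in V₂.
M9-target : ∀ i j {b} → Respects (M9 i j) b → j ≡ fromBool b
M9-target 0F 0F refl = refl
M9-target 0F 1F refl = refl
M9-target 1F 0F refl = refl
M9-target 1F 1F refl = refl

M9-from-target : ∀ i b → Respects (M9 i (fromBool b)) b
M9-from-target 0F false = refl
M9-from-target 0F true  = refl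
M9-from-target 1F false = refl
M9-from-target 1F true  = refl

M9-in-arcs-agree : {D : Digraph n} → (∀ (t : Fin 3 ↣ Fin n) → HasMPartition M9 (induced D t)) →
                   ∀ {x x' y} → x ≢ y → x' ≢ y → arc D x y ≡ arc D x' y
M9-in-arcs-agree {D = D} triples {x} {x'} {y} x≢y x'≢y with x ≟ x'
... | yes refl  = refl
... | no x≢x' with triples (vertices (x ∷ x' ∷ y ∷ []) ((x≢x' ∷ x≢y ∷ []) ∷ (x'≢y ∷ []) ∷ [] ∷ []))
...   | _ , valid = fromBool-injective (trans (sym (M9-target _ _ (valid 0F 2F λ ())))
                                              (M9-target _ _ (valid 1F 2F λ ())))

M9-partition-from-triples : (D : Digraph (suc (suc k))) →
                            (∀ (t : Fin 3 ↣ Fin (suc (suc k))) → HasMPartition M9 (induced D t)) →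
                            HasMPartition M9 D
M9-partition-from-triples D triples = part , valid
  where
  part : Fin _ → Fin 2
  part y = fromBool (arc D (punchIn y 0F) y)

  valid : IsMPartition M9 D part
  valid x y x≢y = subst (λ j → Respects (M9 (part x) j) (arc D x y))
                        (cong fromBool (M9-in-arcs-agree {D = D} triples x≢y (punchInᵢ≢i y 0F)))
                        (M9-from-target (part x) (arc D x y))

large-not-minimal-M9 : (D : Digraph n) → 3 < n → ¬ MinimalObstruction M9 D
large-not-minimal-M9 {1}           _ (s≤s ())
large-not-minimal-M9 {suc (suc _)} D 3<n (¬part , proper) =
  ¬part (M9-partition-from-triples D λ t → proper 3 t 3<n)

minimal-M9⇒ : (D : Digraph n) → MinimalObstruction M9 D → n ≡ 3
minimal-M9⇒ {n} D minimal with n ≤? 3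
... | yes n≤3 = order-three M9 {D} realises-M9 minimal n≤3
... | no n≰3  = contradiction minimal (large-not-minimal-M9 D (≰⇒> n≰3))

-- M10

M10-arc-target : ∀ i j → Respects (M10 i j) true → j ≡ 1F
M10-arc-target 0F 0F ()
M10-arc-target 0F 1F ()
M10-arc-target 1F 0F ()
M10-arc-target 1F 1F _ = refl

asymmetric⇒¬M10-partition : {D : Digraph n} {x y : Fin n} → arc D x y ≡ true → arc D y x ≡ false →
                            ¬ HasMPartition M10 D
asymmetric⇒¬M10-partition {D = D} {x} {y} xy yx (part , valid) =
  contradiction (trans (sym yx) (V₂-adjacent {D = D} valid (≢-sym x≢y) py px)) λ ()
  where
  open SinkSplitPartitions sinkSplit-M10
  x≢y = arc⇒≢ D xy
  px = nonSink-in-V₂ {D = D} valid (y , xy)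
  py = M10-arc-target (part x) (part y) (subst (Respects (M10 (part x) (part y))) xy (valid x y x≢y))

asymmetric-arc-spans : {D : Digraph n} {x y : Fin n} → MinimalObstruction M10 D →
                       arc D x y ≡ true → arc D y x ≡ false → Isomorphic D asymArc
asymmetric-arc-spans {D = D} {x} {y} minimal xy yx =
  spanning⇒isomorphic {D = D} {E = asymArc} t n≤2 arcs
  where
  t = vertices (x ∷ y ∷ []) ((arc⇒≢ D xy ∷ []) ∷ [] ∷ [])

  n≤2 = minimal-bound M10 {D} minimal t (asymmetric⇒¬M10-partition {D = induced D t} {0F} {1F} xy yx)

  arcs : ∀ i j → arc D (to t i) (to t j) ≡ arc asymArc i j
  arcs 0F 0F = loopless D x
  arcs 0F 1F = xy
  arcs 1F 0F = yx
  arcs 1F 1F = loopless D y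

induces-P3 : {D : Digraph n} {a b c : Fin n} → Symmetric D →
             arc D a b ≡ true → arc D c b ≡ true → arc D a c ≡ false →
             let abc = a ∷ b ∷ c ∷ [] in ∀ i j → arc D (lookup abc i) (lookup abc j) ≡ arc bioP3 i j
induces-P3 {D = D} {a} {b} {c} symmetric ab cb ac = arcs
  where
  arcs : let abc = a ∷ b ∷ c ∷ [] in ∀ i j → arc D (lookup abc i) (lookup abc j) ≡ arc bioP3 i j
  arcs 0F 0F = loopless D a
  arcs 0F 1F = ab
  arcs 0F 2F = ac
  arcs 1F 0F = trans (symmetric b a) ab
  arcs 1F 1F = loopless D b
  arcs 1F 2F = trans (symmetric b c) cb
  arcs 2F 0F = trans (symmetric c a) ac
  arcs 2F 1F = cb
  arcs 2F 2F = loopless D c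

-- Otherwise x, x', y, y' would be four distinct vertices.
small-conflict-target : {D : Digraph n} {x x' y y' : Fin n} → Symmetric D → n ≤ 3 →
                        x ≢ y → arc D x x' ≡ true → arc D y y' ≡ true → arc D x y ≡ false →
                        y' ≡ x'
small-conflict-target {D = D} {x} {x'} {y} {y'} symmetric n≤3 x≢y xx' yy' xy with y' ≟ x'
... | yes y'≡x' = y'≡x'
... | no y'≢x' = contradiction n≤3 (<⇒≱ (injective⇒≤ (lookup-injective distinct _ _)))
  where
  y'≢x : y' ≢ x
  y'≢x refl = contradiction (trans (sym xy) (trans (symmetric x y) yy')) λ ()

  distinct : Unique (x ∷ x' ∷ y ∷ y' ∷ [])
  distinct = (arc⇒≢ D xx' ∷ x≢y ∷ ≢-sym y'≢x ∷ [])
           ∷ (arc-split⇒≢ {D = D} xx' xy ∷ ≢-sym y'≢x' ∷ [])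
           ∷ (arc⇒≢ D yy' ∷ [])
           ∷ [] ∷ []

symmetric-minimal-M10 : {D : Digraph n} → MinimalObstruction M10 D → Symmetric D →
                        Isomorphic D bio2K2 ⊎ Isomorphic D bioP3
symmetric-minimal-M10 {n} {D} minimal@(¬part , _) symmetric with hasConflict? D
... | no ¬c = contradiction (¬conflict⇒partition {D = D} into-sink ¬c) ¬part
  where
  open SinkSplitPartitions sinkSplit-M10

  into-sink : ∀ {x y} → NonSink D x → ¬ NonSink D y → arc D x y ≡ false
  into-sink {x} {y} _ ¬sy = ¬-not λ xy → ¬sy (x , trans (symmetric y x) xy)
... | yes (x , y , c@(x≢y , (x' , xx') , (y' , yy') , xy)) with n ≤? 3
...   | no n≰3 =
  let q , n≤4 , superorientation = conflict-spans-2K2 c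
  in inj₁ (spanning⇒isomorphic {D = D} {E = bio2K2} q n≤4
             (symmetric-superorientation {E = induced D q} (λ _ _ → symmetric _ _) superorientation))
  where open LargeObstruction sinkSplit-M10 {D = D} minimal (≰⇒> n≰3)
...   | yes n≤3 with small-conflict-target {D = D} symmetric n≤3 x≢y xx' yy' xy
...     | refl =
  inj₂ (spanning⇒isomorphic {D = D} {E = bioP3} t n≤3 (induces-P3 {D = D} symmetric xx' yy' xy))
  where
  t = vertices (x ∷ x' ∷ y ∷ [])
               ((arc⇒≢ D xx' ∷ x≢y ∷ []) ∷ (arc-split⇒≢ {D = D} xx' xy ∷ []) ∷ [] ∷ [])

minimal-M10⇒ : (D : Digraph n) → MinimalObstruction M10 D →
               Isomorphic D asymArc ⊎ Isomorphic D bio2K2 ⊎ Isomorphic D bioP3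
minimal-M10⇒ D minimal with asymmetricArc? D
... | yes (_ , _ , xy , yx) = inj₁ (asymmetric-arc-spans {D = D} minimal xy yx)
... | no ¬asymmetric        =
  inj₂ (symmetric-minimal-M10 {D = D} minimal (¬asymmetric⇒symmetric {D = D} ¬asymmetric))

asymArc-minimal : MinimalObstruction M10 asymArc
asymArc-minimal = minimal-by-deletion-search M10 asymArc
  (asymmetric⇒¬M10-partition {D = asymArc} {0F} {1F} refl refl) _

bio2K2-minimal : MinimalObstruction M10 bio2K2
bio2K2-minimal = minimal-by-deletion-search M10 bio2K2
  (conflict⇒¬partition {D = bio2K2} {0F} {2F} ((λ ()) , (1F , refl) , (3F , refl) , refl)) _
  where open SinkSplitPartitions sinkSplit-M10

bioP3-minimal : MinimalObstruction M10 bioP3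
bioP3-minimal = minimal-by-deletion-search M10 bioP3
  (conflict⇒¬partition {D = bioP3} {0F} {2F} ((λ ()) , (1F , refl) , (1F , refl) , refl)) _
  where open SinkSplitPartitions sinkSplit-M10

minimal-M10⇐ : (D : Digraph n) → Isomorphic D asymArc ⊎ Isomorphic D bio2K2 ⊎ Isomorphic D bioP3 →
               MinimalObstruction M10 D
minimal-M10⇐ D = [ isomorphic-minimal M10 {D} {asymArc} asymArc-minimal
                 , [ isomorphic-minimal M10 {D} {bio2K2} bio2K2-minimal
                   , isomorphic-minimal M10 {D} {bioP3} bioP3-minimal ] ]

theorem2 : (∀ n (D : Digraph n) → MinimalObstruction M8 D ⇔
    ((n ≡ 3 × ¬ HasMPartition M8 D) ⊎ SuperorientationOf twoK2 D))
    × (∀ n (D : Digraph n) → MinimalObstruction M9 D ⇔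
    (n ≡ 3 × ¬ HasMPartition M9 D))
    × (∀ n (D : Digraph n) → MinimalObstruction M10 D ⇔
    (Isomorphic D asymArc ⊎ Isomorphic D bio2K2 ⊎ Isomorphic D bioP3))
theorem2 =
  (λ _ D → mk⇔ (minimal-M8⇒ D) (minimal-M8⇐ D)) ,
  (λ _ D → mk⇔ (λ minimal → minimal-M9⇒ D minimal , proj₁ minimal)
                λ { (refl , ¬part) → three-vertex-minimal M9 {D} realises-M9 ¬part }) ,
  (λ _ D → mk⇔ (minimal-M10⇒ D) (minimal-M10⇐ D))
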